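{- There exists an arrangement of $15$ distinct lines in $\mathbb{P}^2(\mathbb{F}_{2^4})$ with exactly $35$ intersection points, each of which is a triple point (lies on exactly three of the lines), and no other intersection points.
   Context: An intersection point of a line arrangement is a point lying on at least two of its lines. -}

module Defs where

open import Data.Bool using (Bool; true; false; _xor_; _∧_; if_then_else_)
open import Data.Bool.Properties using () renaming (_≟_ to _≟B_)
open import Data.Nat using (ℕ; zero; suc)
open import Data.Fin using (Fin)
open import Data.List using (List; length; filter; allFin)
open import Data.Product using (Σ; _×_; _,_; ∃)
open import Relation.Binary.PropositionalEquality using (_≡_; _≢_; refl; cong)
open import Relation.Nullary using (Dec; yes; no; ¬_)
open import Relation.Nullary.Decidable using (map′)

-- The field F_{2^4} = F_2[x]/(x^4 + x + 1).
-- An element a0 + a1 x + a2 x^2 + a3 x^3 is stored as its four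
-- coefficients in F_2 = Bool (xor = addition, ∧ = multiplication).

record F16 : Set where
  constructor mkF
  field
    c0 c1 c2 c3 : Bool

open F16

0F : F16
0F = mkF false false false false

1F : F16
1F = mkF true false false false

_+F_ : F16 → F16 → F16
mkF a0 a1 a2 a3 +F mkF b0 b1 b2 b3 =
  mkF (a0 xor b0) (a1 xor b1) (a2 xor b2) (a3 xor b3)

infixl 6 _+F_
infixl 7 _*F_

-- polynomial product followed by reduction with x^4 = x + 1
_*F_ : F16 → F16 → F16
mkF a0 a1 a2 a3 *F mkF b0 b1 b2 b3 =
  mkF (p0 xor p4) (p1 xor p4 xor p5) (p2 xor p5 xor p6) (p3 xor p6)
  where
  p0 = a0 ∧ b0
  p1 = (a0 ∧ b1) xor (a1 ∧ b0)
  p2 = (a0 ∧ b2) xor (a1 ∧ b1) xor (a2 ∧ b0)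
  p3 = (a0 ∧ b3) xor (a1 ∧ b2) xor (a2 ∧ b1) xor (a3 ∧ b0)
  p4 = (a1 ∧ b3) xor (a2 ∧ b2) xor (a3 ∧ b1)
  p5 = (a2 ∧ b3) xor (a3 ∧ b2)
  p6 = a3 ∧ b3

_≟F_ : (a b : F16) → Dec (a ≡ b)
mkF a0 a1 a2 a3 ≟F mkF b0 b1 b2 b3 with a0 ≟B b0 | a1 ≟B b1 | a2 ≟B b2 | a3 ≟B b3
... | yes refl | yes refl | yes refl | yes refl = yes refl
... | no ne | _ | _ | _ = no λ { refl → ne refl }
... | yes _ | no ne | _ | _ = no λ { refl → ne refl }
... | yes _ | yes _ | no ne | _ = no λ { refl → ne refl }
... | yes _ | yes _ | yes _ | no ne = no λ { refl → ne refl }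

-- Homogeneous coordinates in F16^3.  A point of P^2(F16) is represented
-- by a nonzero triple, two triples representing the same point iff they
-- are proportional.  Dually, a line {a x + b y + c z = 0} is represented
-- by its nonzero coefficient triple (a, b, c), up to proportionality.

record Triple : Set where
  constructor ⟨_,_,_⟩
  field
    x y z : F16

NonZero3 : Triple → Set
NonZero3 t = ¬ (t ≡ ⟨ 0F , 0F , 0F ⟩)

scale : F16 → Triple → Triple
scale c ⟨ a , b , d ⟩ = ⟨ c *F a , c *F b , c *F d ⟩

_∼_ : Triple → Triple → Set
u ∼ v = Σ F16 λ c → (c ≢ 0F) × (u ≡ scale c v)

dot : Triple → Triple → F16
dot ⟨ a , b , c ⟩ ⟨ x , y , z ⟩ = a *F x +F b *F y +F c *F z

OnLine : Triple → Triple → Set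
OnLine p l = dot l p ≡ 0F

onLine? : (p l : Triple) → Dec (OnLine p l)
onLine? p l = dot l p ≟F 0F

linesThrough : {n : ℕ} → (Fin n → Triple) → Triple → ℕ
linesThrough {n} L p = length (filter (λ i → onLine? p (L i)) (allFin n))

-- Let W be the F₂-span in F₁₆³ of e₁, e₂, e₃ and v = (α, α², α³), where α is
-- a root of x⁴ + x + 1; since α ∉ F₂, these are F₂-independent and W ≅ F₂⁴.  The
-- 15 nonzero vectors of W are taken as lines.  If a, b ∈ W then a + b is an
-- F₁₆-combination of a and b, so the line a + b passes through the meet a × b
-- of the lines a and b: each of the 35 planes {0, a, b, a + b} of W yields a
-- triple point, and every pair of lines lies in exactly one such plane.  That
-- these 35 points are distinct and lie on no fourth line is a finite check,
-- decided by evaluation.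
module Submission where

open import Defs
open import Data.Bool using (Bool; true; false)
open import Data.Nat using (ℕ; _≤_; _≤?_) renaming (_≟_ to _≟ℕ_)
open import Data.Fin using (Fin; _≟_)
open import Data.Fin.Properties using (all?; any?)
open import Data.Product using (Σ; _×_; _,_; ∃)
open import Data.Sum using (inj₁; inj₂)
open import Data.Vec using ([]; _∷_; lookup)
open import Relation.Binary.PropositionalEquality using (_≡_; _≢_; refl)
open import Relation.Nullary using (¬_; Dec)
open import Relation.Nullary.Decidable
  using (map′; ¬?; _×-dec_; _⊎-dec_; _→-dec_; from-yes)
open import Relation.Unary using (Pred; Decidable)

∀-Bool? : ∀ {p} {P : Pred Bool p} → Decidable P → Dec (∀ b → P b)
∀-Bool? P? = map′ (λ { (t , f) true → t ; (t , f) false → f })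
                  (λ h → h true , h false)
                  (P? true ×-dec P? false)

∃-Bool? : ∀ {p} {P : Pred Bool p} → Decidable P → Dec (∃ P)
∃-Bool? P? = map′ (λ { (inj₁ t) → true , t ; (inj₂ f) → false , f })
                  (λ { (true , t) → inj₁ t ; (false , f) → inj₂ f })
                  (P? true ⊎-dec P? false)

∀-F16? : ∀ {p} {P : Pred F16 p} → Decidable P → Dec (∀ a → P a)
∀-F16? P? = map′ (λ h → λ { (mkF a b c d) → h a b c d })
                 (λ h a b c d → h (mkF a b c d))
                 (∀-Bool? λ a → ∀-Bool? λ b → ∀-Bool? λ c → ∀-Bool? λ d →
                   P? (mkF a b c d))

∃-F16? : ∀ {p} {P : Pred F16 p} → Decidable P → Dec (∃ P)
∃-F16? P? = map′ (λ { (a , b , c , d , h) → mkF a b c d , h })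
                 (λ { (mkF a b c d , h) → a , b , c , d , h })
                 (∃-Bool? λ a → ∃-Bool? λ b → ∃-Bool? λ c → ∃-Bool? λ d →
                   P? (mkF a b c d))

∀-Triple? : ∀ {p} {P : Pred Triple p} → Decidable P → Dec (∀ t → P t)
∀-Triple? P? = map′ (λ h → λ { ⟨ a , b , c ⟩ → h a b c })
                    (λ h a b c → h ⟨ a , b , c ⟩)
                    (∀-F16? λ a → ∀-F16? λ b → ∀-F16? λ c → P? ⟨ a , b , c ⟩)

_≟T_ : (u v : Triple) → Dec (u ≡ v)
⟨ a , b , c ⟩ ≟T ⟨ a′ , b′ , c′ ⟩ =
  map′ (λ { (refl , refl , refl) → refl })
       (λ { refl → refl , refl , refl })
       (a ≟F a′ ×-dec b ≟F b′ ×-dec c ≟F c′)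

nonZero3? : (t : Triple) → Dec (NonZero3 t)
nonZero3? t = ¬? (t ≟T ⟨ 0F , 0F , 0F ⟩)

_∼?_ : (u v : Triple) → Dec (u ∼ v)
u ∼? v = ∃-F16? λ c → ¬? (c ≟F 0F) ×-dec u ≟T scale c v

PairwiseInequivalent : {n : ℕ} → (Fin n → Triple) → Set
PairwiseInequivalent V = ∀ i j → i ≢ j → ¬ (V i ∼ V j)

pairwiseInequivalent? : {n : ℕ} (V : Fin n → Triple) →
                        Dec (PairwiseInequivalent V)
pairwiseInequivalent? V = all? λ i → all? λ j → ¬? (i ≟ j) →-dec ¬? (V i ∼? V j)

_⊕_ : Triple → Triple → Triple
⟨ a , b , c ⟩ ⊕ ⟨ a′ , b′ , c′ ⟩ = ⟨ a +F a′ , b +F b′ , c +F c′ ⟩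

-- The cross product, which in characteristic 2 needs no signs.
_⊗_ : Triple → Triple → Triple
⟨ a , b , c ⟩ ⊗ ⟨ a′ , b′ , c′ ⟩ =
  ⟨ b *F c′ +F c *F b′ , c *F a′ +F a *F c′ , a *F b′ +F b *F a′ ⟩

infixl 6 _⊕_
infix 5.5 _⊗_

α : F16
α = mkF false true false false

e₁ e₂ e₃ v : Triple
e₁ = ⟨ 1F , 0F , 0F ⟩
e₂ = ⟨ 0F , 1F , 0F ⟩
e₃ = ⟨ 0F , 0F , 1F ⟩
v  = ⟨ α , α *F α , α *F α *F α ⟩

arrangement : Fin 15 → Triple
arrangement = lookup
  ( v ∷ e₁ ∷ v ⊕ e₁ ∷ e₂ ∷ v ⊕ e₂ ∷ e₁ ⊕ e₂ ∷ v ⊕ e₁ ⊕ e₂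
  ∷ e₃ ∷ v ⊕ e₃ ∷ e₁ ⊕ e₃ ∷ v ⊕ e₁ ⊕ e₃ ∷ e₂ ⊕ e₃ ∷ v ⊕ e₂ ⊕ e₃
  ∷ e₁ ⊕ e₂ ⊕ e₃ ∷ v ⊕ e₁ ⊕ e₂ ⊕ e₃ ∷ [])

-- One spanning pair {a, b} for each 2-dimensional F₂-subspace of W.
triplePoints : Fin 35 → Triple
triplePoints = lookup
  ( v ⊗ e₁ ∷ v ⊗ e₂ ∷ v ⊗ e₁ ⊕ e₂ ∷ v ⊗ e₃ ∷ v ⊗ e₁ ⊕ e₃ ∷ v ⊗ e₂ ⊕ e₃
  ∷ v ⊗ e₁ ⊕ e₂ ⊕ e₃
  ∷ e₁ ⊗ e₂ ∷ e₁ ⊗ v ⊕ e₂ ∷ e₁ ⊗ e₃ ∷ e₁ ⊗ v ⊕ e₃ ∷ e₁ ⊗ e₂ ⊕ e₃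
  ∷ e₁ ⊗ v ⊕ e₂ ⊕ e₃
  ∷ v ⊕ e₁ ⊗ e₂ ∷ v ⊕ e₁ ⊗ v ⊕ e₂ ∷ v ⊕ e₁ ⊗ e₃ ∷ v ⊕ e₁ ⊗ v ⊕ e₃
  ∷ v ⊕ e₁ ⊗ e₂ ⊕ e₃ ∷ v ⊕ e₁ ⊗ v ⊕ e₂ ⊕ e₃
  ∷ e₂ ⊗ e₃ ∷ e₂ ⊗ v ⊕ e₃ ∷ e₂ ⊗ e₁ ⊕ e₃ ∷ e₂ ⊗ v ⊕ e₁ ⊕ e₃
  ∷ v ⊕ e₂ ⊗ e₃ ∷ v ⊕ e₂ ⊗ v ⊕ e₃ ∷ v ⊕ e₂ ⊗ e₁ ⊕ e₃ ∷ v ⊕ e₂ ⊗ v ⊕ e₁ ⊕ e₃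
  ∷ e₁ ⊕ e₂ ⊗ e₃ ∷ e₁ ⊕ e₂ ⊗ v ⊕ e₃ ∷ e₁ ⊕ e₂ ⊗ e₁ ⊕ e₃
  ∷ e₁ ⊕ e₂ ⊗ v ⊕ e₁ ⊕ e₃
  ∷ v ⊕ e₁ ⊕ e₂ ⊗ e₃ ∷ v ⊕ e₁ ⊕ e₂ ⊗ v ⊕ e₃ ∷ v ⊕ e₁ ⊕ e₂ ⊗ e₁ ⊕ e₃
  ∷ v ⊕ e₁ ⊕ e₂ ⊗ v ⊕ e₁ ⊕ e₃ ∷ [])

allTriplePointsCovered? :
  Dec ((p : Triple) → NonZero3 p → 2 ≤ linesThrough arrangement p →
       Σ (Fin 35) λ k → p ∼ triplePoints k)
allTriplePointsCovered? =
  ∀-Triple? λ p → nonZero3? p →-dec 2 ≤? linesThrough arrangement p →-dec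
                  any? λ k → p ∼? triplePoints k

mainTheorem4 :
    Σ (Fin 15 → Triple) λ L →
      ((i : Fin 15) → NonZero3 (L i)) ×
      ((i j : Fin 15) → i ≢ j → ¬ (L i ∼ L j)) ×
      Σ (Fin 35 → Triple) λ P →
        ((k : Fin 35) → NonZero3 (P k)) ×
        ((k k′ : Fin 35) → k ≢ k′ → ¬ (P k ∼ P k′)) ×
        ((k : Fin 35) → linesThrough L (P k) ≡ 3) ×
        ((p : Triple) → NonZero3 p → 2 ≤ linesThrough L p →
          Σ (Fin 35) λ k → p ∼ P k)
mainTheorem4 =
  arrangement ,
  from-yes (all? λ i → nonZero3? (arrangement i)) ,
  from-yes (pairwiseInequivalent? arrangement) ,
  triplePoints ,
  from-yes (all? λ k → nonZero3? (triplePoints k)) ,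
  from-yes (pairwiseInequivalent? triplePoints) ,
  from-yes (all? λ k → linesThrough arrangement (triplePoints k) ≟ℕ 3) ,
  from-yes allTriplePointsCovered?
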